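{- Let $H$ be a connected $m$-uniform hypergraph and let $\phi: E(\overleftrightarrow{B_H}) \to \mathbb{S}_k$ be a permutation voltage assignment on the incidence graph $B_H$, with associated $k$-fold covering $H_B^\phi$ of $H$. Then $H_B^\phi$ is connected if and only if there exists a vertex $v$ of $B_H$ such that for any $i,j \in [k]$, $B_H$ contains a closed walk $W$ starting from $v$ with $i=\phi(W)(j)$.
   Context: A hypergraph $H$ has vertex set $V(H)$ and edge set $E(H)$ of subsets of $V(H)$; it is $m$-uniform if every edge has $m$ vertices; it is connected if any two vertices are joined by a walk $v_0e_1v_1\cdots e_tv_t$ with $v_{i-1}\neq v_i$, $\{v_{i-1},v_i\}\subseteq e_i$. The incidence graph $B_H$ is the bipartite graph on $V(H)\cup E(H)$ with $v$ adjacent to $e$ iff $v\in e$. $\mathbb{S}_k$ is the symmetric group on $[k]$, product $(\sigma\tau)(j)=\sigma(\tau(j))$. $\overleftrightarrow{B_H}$ replaces each edge $\{x,y\}$ of $B_H$ by arcs $(x,y)$, $(y,x)$; a permutation voltage assignment satisfies $\phi(y,x)=\phi(x,y)^{ -1}$. The derived graph $B_H^\phi$ has vertex set $(V(H)\cup E(H))\times[k]$, with $(x,i)$ adjacent to $(y,j)$ iff $\{x,y\}\in E(B_H)$ and $i=\phi(x,y)(j)$. The hypergraph $H_B^\phi$ has vertex set $V(H)\times[k]$ and, for each $e\in E(H)$ and $i\in[k]$, an edge $(e,i)=\{(v,\phi(v,e)(i)): v\in e\}$ (the set of vertices of $B_H^\phi$ adjacent to $(e,i)$). For a walk $W=x_0x_1\cdots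 x_t$ in $B_H$, $\phi(W)=\phi(x_0,x_1)\cdots\phi(x_{t-1},x_t)$. -}

module Defs where

open import Data.Nat using (ℕ)
open import Data.Fin using (Fin)
open import Data.Fin.Subset using (Subset; _∈_; ∣_∣)
open import Data.Fin.Permutation using (Permutation′; _⟨$⟩ʳ_; flip; id)
open import Data.Sum using (_⊎_; inj₁; inj₂)
open import Data.Product using (_×_; _,_; Σ)
open import Data.Empty using (⊥)
open import Relation.Binary.PropositionalEquality using (_≡_; _≢_)
open import Function.Definitions using (Injective)

record Hypergraph : Set where
  field
    nV    : ℕ
    nE    : ℕ
    edge  : Fin nE → Subset nV
    edge-injective : Injective _≡_ _≡_ edge
open Hypergraph public

Uniform : ℕ → Hypergraph → Set
Uniform m H = ∀ f → ∣ edge H f ∣ ≡ m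

data HWalk {V E : Set} (_∈ₕ_ : V → E → Set) : V → V → Set where
  here : ∀ {x} → HWalk _∈ₕ_ x x
  step : ∀ {x y z} (e : E) → x ≢ y → x ∈ₕ e → y ∈ₕ e → HWalk _∈ₕ_ y z → HWalk _∈ₕ_ x z

ConnectedRel : {V E : Set} → (V → E → Set) → Set
ConnectedRel {V} _∈ₕ_ = ∀ (x y : V) → HWalk _∈ₕ_ x y

Mem : (H : Hypergraph) → Fin (nV H) → Fin (nE H) → Set
Mem H v f = v ∈ edge H f

Connected : Hypergraph → Set
Connected H = ConnectedRel (Mem H)

-- A permutation voltage assignment on the arcs of the incidence graph B_H:
-- φ v f is the voltage of the arc (v, f); the arc (f, v) gets the inverse,
-- so φ(y,x) = φ(x,y)⁻¹ holds by construction.  (Values on non-incident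
-- pairs are irrelevant.)
Voltage : Hypergraph → ℕ → Set
Voltage H k = Fin (nV H) → Fin (nE H) → Permutation′ k

BNode : Hypergraph → Set
BNode H = Fin (nV H) ⊎ Fin (nE H)

BAdj : (H : Hypergraph) → BNode H → BNode H → Set
BAdj H (inj₁ v) (inj₂ f) = v ∈ edge H f
BAdj H (inj₂ f) (inj₁ v) = v ∈ edge H f
BAdj H (inj₁ _) (inj₁ _) = ⊥
BAdj H (inj₂ _) (inj₂ _) = ⊥

arcVolt : (H : Hypergraph) {k : ℕ} → Voltage H k → BNode H → BNode H → Permutation′ k
arcVolt H φ (inj₁ v) (inj₂ f) = φ v f
arcVolt H φ (inj₂ f) (inj₁ v) = flip (φ v f)
arcVolt H φ (inj₁ _) (inj₁ _) = id
arcVolt H φ (inj₂ _) (inj₂ _) = id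

data BWalk (H : Hypergraph) : BNode H → BNode H → Set where
  nil  : ∀ {x} → BWalk H x x
  cons : ∀ {x y z} → BAdj H x y → BWalk H y z → BWalk H x z

-- φ(W) = φ(x₀,x₁) ⋯ φ(x_{t-1},x_t) with (στ)(j) = σ(τ(j)), applied to j
walkVolt : (H : Hypergraph) {k : ℕ} (φ : Voltage H k) {x y : BNode H} →
           BWalk H x y → Fin k → Fin k
walkVolt H φ nil j = j
walkVolt H φ (cons {x} {y} _ W) j = arcVolt H φ x y ⟨$⟩ʳ walkVolt H φ W j

-- Membership relation of the derived hypergraph H_B^φ:
-- vertex set V(H) × [k], edge (f, i) = {(v, φ(v,f)(i)) : v ∈ f}.
LiftMem : (H : Hypergraph) {k : ℕ} → Voltage H k →
          Fin (nV H) × Fin k → Fin (nE H) × Fin k → Set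
LiftMem H φ (v , j) (f , i) = (v ∈ edge H f) × (j ≡ φ v f ⟨$⟩ʳ i)

LiftConnected : (H : Hypergraph) {k : ℕ} → Voltage H k → Set
LiftConnected H φ = ConnectedRel (LiftMem H φ)

{-# OPTIONS --safe #-}
module Submission where

-- A walk in the cover H_B^φ from (x, a) to (y, b) is the same thing as a
-- walk W from x to y in B_H with a = φ(W)(b): project the lifted walk, or
-- lift a base walk one hyperedge at a time.  So H_B^φ is connected iff, for
-- one base vertex w, closed walks at w realise every pair of fibre indices:
-- any two lifted vertices are joined through the fibre over w, using
-- connectivity of H.  Transitivity at an edge node moves to a vertex of
-- that edge by conjugating with the connecting arc; an empty edge node only
-- has the trivial closed walk.

open import Defs
open import Data.Nat using (ℕ; _≤_)
open import Data.Fin using (Fin; _≟_; fromℕ<)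
open import Data.Fin.Subset using (Nonempty)
open import Data.Fin.Subset.Properties using (nonempty?)
open import Data.Fin.Permutation using (_⟨$⟩ʳ_; _⟨$⟩ˡ_; inverseˡ; inverseʳ)
open import Data.Sum using (inj₁; inj₂)
open import Data.Product using (Σ; _×_; _,_; proj₁; proj₂)
open import Relation.Nullary using (¬_; yes; no; contradiction)
open import Relation.Binary.PropositionalEquality
  using (_≡_; refl; sym; trans; cong; module ≡-Reasoning)

module _ {V E : Set} {_∈ₕ_ : V → E → Set} where

  _++ʰ_ : ∀ {x y z} → HWalk _∈ₕ_ x y → HWalk _∈ₕ_ y z → HWalk _∈ₕ_ x z
  here                   ++ʰ U = U
  step e x≢y x∈ y∈ W ++ʰ U = step e x≢y x∈ y∈ (W ++ʰ U)

  reverseʰ : ∀ {x y} → HWalk _∈ₕ_ x y → HWalk _∈ₕ_ y x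
  reverseʰ W = go W here
    where
    go : ∀ {x y z} → HWalk _∈ₕ_ x y → HWalk _∈ₕ_ x z → HWalk _∈ₕ_ y z
    go here                  acc = acc
    go (step e x≢y x∈ y∈ W) acc = go W (step e (λ y≡x → x≢y (sym y≡x)) y∈ x∈ acc)

module _ {H : Hypergraph} where

  _++ᴮ_ : ∀ {x y z} → BWalk H x y → BWalk H y z → BWalk H x z
  nil      ++ᴮ U = U
  cons a W ++ᴮ U = cons a (W ++ᴮ U)

  BAdj-sym : ∀ {u v} → BAdj H u v → BAdj H v u
  BAdj-sym {inj₁ _} {inj₂ _} v∈f = v∈f
  BAdj-sym {inj₂ _} {inj₁ _} v∈f = v∈f

  HWalk⇒BWalk : ∀ {x y} → HWalk (Mem H) x y → BWalk H (inj₁ x) (inj₁ y)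
  HWalk⇒BWalk here                 = nil
  HWalk⇒BWalk (step f _ x∈f y∈f W) =
    cons {y = inj₂ f} x∈f (cons {y = inj₁ _} y∈f (HWalk⇒BWalk W))

  module _ {k : ℕ} (φ : Voltage H k) where

    walkVolt-++ : ∀ {x y z} (W : BWalk H x y) (U : BWalk H y z) j →
                  walkVolt H φ (W ++ᴮ U) j ≡ walkVolt H φ W (walkVolt H φ U j)
    walkVolt-++ nil                U j = refl
    walkVolt-++ (cons {x} {y} _ W) U j = cong (arcVolt H φ x y ⟨$⟩ʳ_) (walkVolt-++ W U j)

    arcVolt-inverse : ∀ {u v} → BAdj H u v → ∀ j →
                      arcVolt H φ u v ⟨$⟩ʳ (arcVolt H φ v u ⟨$⟩ʳ j) ≡ j
    arcVolt-inverse {inj₁ x} {inj₂ f} _ j = inverseʳ (φ x f)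
    arcVolt-inverse {inj₂ f} {inj₁ x} _ j = inverseˡ (φ x f)

    LiftWalk : Fin (nV H) × Fin k → Fin (nV H) × Fin k → Set
    LiftWalk = HWalk (LiftMem H φ)

    lift-BWalk : ∀ {x y a b} (W : BWalk H (inj₁ x) (inj₁ y)) →
                 a ≡ walkVolt H φ W b → LiftWalk (x , a) (y , b)
    lift-BWalk nil refl = here
    lift-BWalk (cons {y = inj₁ _} () _)
    lift-BWalk (cons {y = inj₂ _} _ (cons {y = inj₂ _} () _))
    lift-BWalk {x} {b = b} (cons {y = inj₂ f} x∈f (cons {y = inj₁ x′} x′∈f W)) a≡
      with x ≟ x′
    -- a hypergraph walk step needs distinct endpoints, so a detour x f x is dropped
    ... | yes refl = lift-BWalk W (trans a≡ (inverseʳ (φ x f)))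
    ... | no  x≢x′ =
      step (f , φ x′ f ⟨$⟩ˡ walkVolt H φ W b) (λ eq → x≢x′ (cong proj₁ eq))
           (x∈f , a≡) (x′∈f , sym (inverseʳ (φ x′ f))) (lift-BWalk W refl)

    project-LiftWalk : ∀ {x y a b} → LiftWalk (x , a) (y , b) →
                       Σ (BWalk H (inj₁ x) (inj₁ y)) (λ W → a ≡ walkVolt H φ W b)
    project-LiftWalk here = nil , refl
    project-LiftWalk {x} {a = a} (step (f , i) _ (x∈f , a≡) (x′∈f , c≡) U)
      with project-LiftWalk U
    ... | W , c≡W = cons {y = inj₂ f} x∈f (cons {y = inj₁ _} x′∈f W) , (begin
      a                                                     ≡⟨ a≡ ⟩
      φ x f ⟨$⟩ʳ i                                          ≡⟨ cong (φ x f ⟨$⟩ʳ_) (sym (inverseˡ (φ _ f))) ⟩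
      φ x f ⟨$⟩ʳ (φ _ f ⟨$⟩ˡ (φ _ f ⟨$⟩ʳ i))                ≡⟨ cong (λ c → φ x f ⟨$⟩ʳ (φ _ f ⟨$⟩ˡ c)) (trans (sym c≡) c≡W) ⟩
      φ x f ⟨$⟩ʳ (φ _ f ⟨$⟩ˡ walkVolt H φ W _)              ∎)
      where open ≡-Reasoning

    VoltageTransitiveAt : BNode H → Set
    VoltageTransitiveAt v = ∀ (i j : Fin k) → Σ (BWalk H v v) (λ W → i ≡ walkVolt H φ W j)

    voltageTransitiveAt-adjacent : ∀ {u v} → BAdj H u v →
                                   VoltageTransitiveAt v → VoltageTransitiveAt u
    voltageTransitiveAt-adjacent {u} {v} uv transitive i j
      with transitive (arcVolt H φ v u ⟨$⟩ʳ i) (arcVolt H φ v u ⟨$⟩ʳ j)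
    ... | W , i′≡ = cons uv (W ++ᴮ cons (BAdj-sym uv) nil) , (begin
      i                                                       ≡⟨ sym (arcVolt-inverse uv i) ⟩
      arcVolt H φ u v ⟨$⟩ʳ (arcVolt H φ v u ⟨$⟩ʳ i)           ≡⟨ cong (arcVolt H φ u v ⟨$⟩ʳ_) i′≡ ⟩
      arcVolt H φ u v ⟨$⟩ʳ walkVolt H φ W (arcVolt H φ v u ⟨$⟩ʳ j)
        ≡⟨ cong (arcVolt H φ u v ⟨$⟩ʳ_) (sym (walkVolt-++ W (cons (BAdj-sym uv) nil) j)) ⟩
      arcVolt H φ u v ⟨$⟩ʳ walkVolt H φ (W ++ᴮ cons (BAdj-sym uv) nil) j ∎)
      where open ≡-Reasoning

    closedWalk-at-empty-edge : ∀ {f} → ¬ Nonempty (edge H f) →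
                               (W : BWalk H (inj₂ f) (inj₂ f)) → ∀ j → walkVolt H φ W j ≡ j
    closedWalk-at-empty-edge _     nil                      j = refl
    closedWalk-at-empty-edge empty (cons {y = inj₁ x} x∈f _) j = contradiction (x , x∈f) empty

    voltageTransitiveAt-vertex : 1 ≤ nV H → ∀ {v} → VoltageTransitiveAt v →
                                 Σ (Fin (nV H)) (λ w → VoltageTransitiveAt (inj₁ w))
    voltageTransitiveAt-vertex _ {inj₁ w} transitive = w , transitive
    voltageTransitiveAt-vertex 1≤nV {inj₂ f} transitive with nonempty? (edge H f)
    ... | yes (x , x∈f) = x , voltageTransitiveAt-adjacent {inj₁ x} {inj₂ f} x∈f transitive
    ... | no  empty     = fromℕ< 1≤nV , λ i j → nil , all-equal i j
      where
      all-equal : ∀ (i j : Fin k) → i ≡ j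
      all-equal i j with transitive i j
      ... | W , i≡ = trans i≡ (closedWalk-at-empty-edge empty W j)

    liftConnected⇒voltageTransitiveAt : LiftConnected H φ → ∀ x → VoltageTransitiveAt (inj₁ x)
    liftConnected⇒voltageTransitiveAt connected x i j = project-LiftWalk (connected (x , i) (x , j))

    liftWalk-via-fibre : ∀ {w x y a b} → VoltageTransitiveAt (inj₁ w) →
                         BWalk H (inj₁ w) (inj₁ x) → BWalk H (inj₁ w) (inj₁ y) →
                         LiftWalk (x , a) (y , b)
    liftWalk-via-fibre {a = a} {b} transitive Wx Wy
      with transitive (walkVolt H φ Wx a) (walkVolt H φ Wy b)
    ... | C , C≡ = reverseʰ (lift-BWalk Wx refl)
                   ++ʰ lift-BWalk (C ++ᴮ Wy) (trans C≡ (sym (walkVolt-++ C Wy b)))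

    voltageTransitiveAt⇒liftConnected : Connected H → ∀ {w} → VoltageTransitiveAt (inj₁ w) →
                                        LiftConnected H φ
    voltageTransitiveAt⇒liftConnected connected {w} transitive (x , _) (y , _) =
      liftWalk-via-fibre transitive (HWalk⇒BWalk (connected w x)) (HWalk⇒BWalk (connected w y))

corollary3p11 : (H : Hypergraph) (m k : ℕ) → 1 ≤ nV H → Uniform m H → Connected H →
    (φ : Voltage H k) →
    (LiftConnected H φ →
       Σ (BNode H) (λ v → ∀ (i j : Fin k) → Σ (BWalk H v v) (λ W → i ≡ walkVolt H φ W j)))
    × (Σ (BNode H) (λ v → ∀ (i j : Fin k) → Σ (BWalk H v v) (λ W → i ≡ walkVolt H φ W j)) →
       LiftConnected H φ)
corollary3p11 H _ _ 1≤nV _ connected φ =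
  (λ liftConnected → inj₁ v₀ , liftConnected⇒voltageTransitiveAt φ liftConnected v₀) ,
  (λ (v , transitive) →
     voltageTransitiveAt⇒liftConnected φ connected
       (proj₂ (voltageTransitiveAt-vertex φ 1≤nV transitive)))
  where
  v₀ : Fin (nV H)
  v₀ = fromℕ< 1≤nV
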